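{- Let $n\ge0$ and $x,y\in\mathbb{Z}[i]$. If $xy\in B_n\setminus\{0\}$, then $x\in B_n\setminus\{0\}$.
   Context: $B_n=\{\sum_{j=0}^n v_j(1+i)^j: v_j\in\{0,\pm1,\pm i\}\}$. -}

module Defs where

open import Data.Integer as ℤ using (ℤ; +_; -[1+_])
open import Data.Nat using (ℕ; zero; suc)
open import Data.Product using (Σ-syntax)
open import Relation.Binary.PropositionalEquality using (_≡_)

record ℤ[i] : Set where
  constructor _+_i
  field
    re : ℤ
    im : ℤ
open ℤ[i] public

infixl 6 _⊕_
infixl 7 _⊗_

0ᵍ : ℤ[i]
0ᵍ = (+ 0) + (+ 0) i

1ᵍ : ℤ[i]
1ᵍ = (+ 1) + (+ 0) i

_⊕_ : ℤ[i] → ℤ[i] → ℤ[i]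
(a + b i) ⊕ (c + d i) = (a ℤ.+ c) + (b ℤ.+ d) i

_⊗_ : ℤ[i] → ℤ[i] → ℤ[i]
(a + b i) ⊗ (c + d i) = (a ℤ.* c ℤ.- b ℤ.* d) + (a ℤ.* d ℤ.+ b ℤ.* c) i

ρ : ℤ[i]
ρ = (+ 1) + (+ 1) i

_^ᵍ_ : ℤ[i] → ℕ → ℤ[i]
z ^ᵍ zero  = 1ᵍ
z ^ᵍ suc k = z ⊗ (z ^ᵍ k)

data Digit : Set where
  d0 d1 d-1 di d-i : Digit

⟦_⟧ : Digit → ℤ[i]
⟦ d0  ⟧ = 0ᵍ
⟦ d1  ⟧ = (+ 1) + (+ 0) i
⟦ d-1 ⟧ = -[1+ 0 ] + (+ 0) i
⟦ di  ⟧ = (+ 0) + (+ 1) i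
⟦ d-i ⟧ = (+ 0) + -[1+ 0 ] i

digitSum : (ℕ → Digit) → ℕ → ℤ[i]
digitSum v zero    = ⟦ v 0 ⟧
digitSum v (suc k) = digitSum v k ⊕ (⟦ v (suc k) ⟧ ⊗ (ρ ^ᵍ suc k))

_∈B_ : ℤ[i] → ℕ → Set
z ∈B n = Σ[ v ∈ (ℕ → Digit) ] digitSum v n ≡ z

-- Divisibility by ρ = 1 + i is decided by the parity of re + im.  The elements of B n not
-- divisible by ρ are exactly the lattice points with odd re + im in the octagon
-- |re|, |im| ≤ half (suc n), |re ± im| ≤ diag n, and its multiples of ρ are ρ B (n - 1).
-- The octagon is invariant under units and conjugation, and it is squeezed between the norm
-- balls N ≤ half (suc n)² and 2 N ≤ diag n²; since N (x y) ≥ 2 N x when y is neither zero nor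
-- a unit, x lies in the octagon whenever x y does.  Hence a divisor x of x y ∈ B n ∖ {0} lies
-- in B n when ρ ∤ x, and when x = ρ x′ the unit digit of x y is 0 and induction on n applies.

module Submission where

open import Defs
open import Data.Nat.Base as ℕ using (ℕ; zero; suc; _≤_; _<_; z≤n; s≤s)
import Data.Nat.Properties as ℕₚ
open import Data.Integer.Base using (ℤ; +_; -[1+_]; _+_; _-_; _*_; -_; ∣_∣)
import Data.Integer.Properties as ℤₚ
open import Data.Integer.Tactic.RingSolver using (solve-∀)
open import Data.Nat.Tactic.RingSolver renaming (solve-∀ to ℕ-solve-∀)
open import Data.Integer.DivMod using (_%ℕ_; _/ℕ_; n%ℕd<d; a≡a%ℕn+[a/ℕn]*n)
open import Data.Product.Base using (Σ; _×_; _,_; proj₁)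
open import Data.Sum.Base using (_⊎_; inj₁; inj₂)
open import Data.Empty using (⊥-elim)
open import Function.Base using (_∘_)
open import Relation.Nullary.Negation using (¬_)
open import Relation.Binary.PropositionalEquality

double-cancel-≤ : ∀ {m n} → m ℕ.+ m ≤ suc (n ℕ.+ n) → m ≤ n
double-cancel-≤ {m} {n} p = ℕₚ.≮⇒≥ λ n<m →
  ℕₚ.<⇒≱ (subst (_≤ m ℕ.+ m) (cong suc (ℕₚ.+-suc n n)) (ℕₚ.+-mono-≤ n<m n<m)) p

double-mono-≤ : ∀ {m n} → m ≤ n → suc (m ℕ.+ m) ≤ suc (n ℕ.+ n)
double-mono-≤ p = s≤s (ℕₚ.+-mono-≤ p p)

square-cancel-≤ : ∀ {m n} → m ℕ.* m ≤ n ℕ.* n → m ≤ n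
square-cancel-≤ p = ℕₚ.≮⇒≥ λ n<m → ℕₚ.<⇒≱ (ℕₚ.*-mono-< n<m n<m) p

∣∣≤-≡ : ∀ {x y k} → x ≡ y → ∣ y ∣ ≤ k → ∣ x ∣ ≤ k
∣∣≤-≡ refl p = p

∣∣≤-≡-neg : ∀ {x y k} → x ≡ - y → ∣ y ∣ ≤ k → ∣ x ∣ ≤ k
∣∣≤-≡-neg {y = y} refl p = subst (_≤ _) (sym (ℤₚ.∣-i∣≡∣i∣ y)) p

∣-∣≤ : ∀ x {k} → ∣ x ∣ ≤ k → ∣ - x ∣ ≤ k
∣-∣≤ x = ∣∣≤-≡-neg {y = x} refl

∣+∣≤ : ∀ x y {m n} → ∣ x ∣ ≤ m → ∣ y ∣ ≤ n → ∣ x + y ∣ ≤ m ℕ.+ n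
∣+∣≤ x y p q = ℕₚ.≤-trans (ℤₚ.∣i+j∣≤∣i∣+∣j∣ x y) (ℕₚ.+-mono-≤ p q)

∣i∣*∣i∣≡i*i : ∀ i → + (∣ i ∣ ℕ.* ∣ i ∣) ≡ i * i
∣i∣*∣i∣≡i*i (+ n)    = ℤₚ.pos-* n n
∣i∣*∣i∣≡i*i -[1+ n ] = refl

double-injective : ∀ {x y} → x + x ≡ y + y → x ≡ y
double-injective {x} {y} eq = ℤₚ.*-cancelʳ-≡ x y (+ 2) (trans (law x) (trans eq (sym (law y))))
  where
  law : ∀ x → x * + 2 ≡ x + x
  law = solve-∀

double≢1 : ∀ x → x + x ≢ + 1
double≢1 (+ zero)          ()
double≢1 (+ suc zero)      ()
double≢1 (+ suc (suc n))   ()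
double≢1 -[1+ n ]          ()

even≢odd : ∀ x k → x + x ≢ + 1 + (k + k)
even≢odd x k eq = double≢1 (x - k) (trans (law₁ x k) (trans (cong (_- (k + k)) eq) (law₂ k)))
  where
  law₁ : ∀ x k → (x - k) + (x - k) ≡ (x + x) - (k + k)
  law₁ = solve-∀
  law₂ : ∀ k → (+ 1 + (k + k)) - (k + k) ≡ + 1
  law₂ = solve-∀

halve : ∀ a → Σ ℤ λ q → a ≡ q + q ⊎ a ≡ + 1 + (q + q)
halve a with a %ℕ 2 | n%ℕd<d a 2 | a≡a%ℕn+[a/ℕn]*n a 2
... | 0           | _            | eq = a /ℕ 2 , inj₁ (trans eq (law₀ (a /ℕ 2)))
  where
  law₀ : ∀ q → + 0 + q * + 2 ≡ q + q
  law₀ = solve-∀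
... | 1           | _            | eq = a /ℕ 2 , inj₂ (trans eq (law₁ (a /ℕ 2)))
  where
  law₁ : ∀ q → + 1 + q * + 2 ≡ + 1 + (q + q)
  law₁ = solve-∀
... | suc (suc _) | s≤s (s≤s ()) | _

iᵍ : ℤ[i]
iᵍ = ⟦ di ⟧

conj : ℤ[i] → ℤ[i]
conj (a + b i) = a + (- b) i

re+im re-im : ℤ[i] → ℤ
re+im z = re z + im z
re-im z = re z - im z

⊕-identityˡ : ∀ z → 0ᵍ ⊕ z ≡ z
⊕-identityˡ (a + b i) = cong₂ _+_i (ℤₚ.+-identityˡ a) (ℤₚ.+-identityˡ b)

⊕-assoc : ∀ x y z → (x ⊕ y) ⊕ z ≡ x ⊕ (y ⊕ z)
⊕-assoc (a + b i) (c + d i) (e + f i) = cong₂ _+_i (ℤₚ.+-assoc a c e) (ℤₚ.+-assoc b d f)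

⊗-identityˡ : ∀ z → 1ᵍ ⊗ z ≡ z
⊗-identityˡ (a + b i) = cong₂ _+_i (re-law a b) (im-law a b)
  where
  re-law : ∀ a b → + 1 * a - + 0 * b ≡ a
  re-law = solve-∀
  im-law : ∀ a b → + 1 * b + + 0 * a ≡ b
  im-law = solve-∀

⊗-comm : ∀ x y → x ⊗ y ≡ y ⊗ x
⊗-comm (a + b i) (c + d i) = cong₂ _+_i (re-law a b c d) (im-law a b c d)
  where
  re-law : ∀ a b c d → a * c - b * d ≡ c * a - d * b
  re-law = solve-∀
  im-law : ∀ a b c d → a * d + b * c ≡ c * b + d * a
  im-law = solve-∀

⊗-assoc : ∀ x y z → (x ⊗ y) ⊗ z ≡ x ⊗ (y ⊗ z)
⊗-assoc (a + b i) (c + d i) (e + f i) = cong₂ _+_i (re-law a b c d e f) (im-law a b c d e f)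
  where
  re-law : ∀ a b c d e f →
           (a * c - b * d) * e - (a * d + b * c) * f ≡ a * (c * e - d * f) - b * (c * f + d * e)
  re-law = solve-∀
  im-law : ∀ a b c d e f →
           (a * c - b * d) * f + (a * d + b * c) * e ≡ a * (c * f + d * e) + b * (c * e - d * f)
  im-law = solve-∀

⊗-distribˡ-⊕ : ∀ x y z → x ⊗ (y ⊕ z) ≡ x ⊗ y ⊕ x ⊗ z
⊗-distribˡ-⊕ (a + b i) (c + d i) (e + f i) = cong₂ _+_i (re-law a b c d e f) (im-law a b c d e f)
  where
  re-law : ∀ a b c d e f → a * (c + e) - b * (d + f) ≡ (a * c - b * d) + (a * e - b * f)
  re-law = solve-∀
  im-law : ∀ a b c d e f → a * (d + f) + b * (c + e) ≡ (a * d + b * c) + (a * f + b * e)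
  im-law = solve-∀

⊗-identityʳ : ∀ z → z ⊗ 1ᵍ ≡ z
⊗-identityʳ z = trans (⊗-comm z 1ᵍ) (⊗-identityˡ z)

⊗-zeroʳ : ∀ z → z ⊗ 0ᵍ ≡ 0ᵍ
⊗-zeroʳ z = ⊗-comm z 0ᵍ

⊗-left-comm : ∀ x y z → x ⊗ (y ⊗ z) ≡ y ⊗ (x ⊗ z)
⊗-left-comm x y z = begin
  x ⊗ (y ⊗ z)  ≡⟨ ⊗-assoc x y z ⟨
  (x ⊗ y) ⊗ z  ≡⟨ cong (_⊗ z) (⊗-comm x y) ⟩
  (y ⊗ x) ⊗ z  ≡⟨ ⊗-assoc y x z ⟩
  y ⊗ (x ⊗ z)  ∎
  where open ≡-Reasoning

conj-⊕ : ∀ x y → conj (x ⊕ y) ≡ conj x ⊕ conj y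
conj-⊕ (a + b i) (c + d i) = cong (λ m → (a + c) + m i) (ℤₚ.neg-distrib-+ b d)

conj-⊗ : ∀ x y → conj (x ⊗ y) ≡ conj x ⊗ conj y
conj-⊗ (a + b i) (c + d i) = cong₂ _+_i (re-law a b c d) (im-law a b c d)
  where
  re-law : ∀ a b c d → a * c - b * d ≡ a * c - (- b) * (- d)
  re-law = solve-∀
  im-law : ∀ a b c d → - (a * d + b * c) ≡ a * (- d) + (- b) * c
  im-law = solve-∀

iᵍ²⊗ : ∀ a b → iᵍ ^ᵍ 2 ⊗ (a + b i) ≡ (- a) + (- b) i
iᵍ²⊗ a b = cong₂ _+_i (re-law a b) (im-law a b)
  where
  re-law : ∀ a b → -[1+ 0 ] * a - + 0 * b ≡ - a
  re-law = solve-∀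
  im-law : ∀ a b → -[1+ 0 ] * b + + 0 * a ≡ - b
  im-law = solve-∀

digitSum-suc : ∀ v n → digitSum v (suc n) ≡ ⟦ v 0 ⟧ ⊕ ρ ⊗ digitSum (v ∘ suc) n
digitSum-suc v zero =
  cong (⟦ v 0 ⟧ ⊕_) (trans (cong (⟦ v 1 ⟧ ⊗_) (⊗-identityʳ ρ)) (⊗-comm ⟦ v 1 ⟧ ρ))
digitSum-suc v (suc n) = begin
  digitSum v (suc n) ⊕ c ⊗ (ρ ⊗ r)          ≡⟨ cong (_⊕ c ⊗ (ρ ⊗ r)) (digitSum-suc v n) ⟩
  (⟦ v 0 ⟧ ⊕ ρ ⊗ s) ⊕ c ⊗ (ρ ⊗ r)           ≡⟨ ⊕-assoc ⟦ v 0 ⟧ (ρ ⊗ s) (c ⊗ (ρ ⊗ r)) ⟩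
  ⟦ v 0 ⟧ ⊕ (ρ ⊗ s ⊕ c ⊗ (ρ ⊗ r))           ≡⟨ cong (λ t → ⟦ v 0 ⟧ ⊕ (ρ ⊗ s ⊕ t)) (⊗-left-comm c ρ r) ⟩
  ⟦ v 0 ⟧ ⊕ (ρ ⊗ s ⊕ ρ ⊗ (c ⊗ r))           ≡⟨ cong (⟦ v 0 ⟧ ⊕_) (⊗-distribˡ-⊕ ρ s (c ⊗ r)) ⟨
  ⟦ v 0 ⟧ ⊕ ρ ⊗ (s ⊕ c ⊗ r)                 ∎
  where
  open ≡-Reasoning
  s = digitSum (v ∘ suc) n
  c = ⟦ v (suc (suc n)) ⟧
  r = ρ ^ᵍ suc n

-- Horner form of the digit expansion, read from the least significant digit.
data B : ℕ → ℤ[i] → Set where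
  [_] : ∀ d → B 0 ⟦ d ⟧
  _∷_ : ∀ {n w} d → B n w → B (suc n) (⟦ d ⟧ ⊕ ρ ⊗ w)

digitSum∈B : ∀ v n → B n (digitSum v n)
digitSum∈B v zero    = [ v 0 ]
digitSum∈B v (suc n) = subst (B (suc n)) (sym (digitSum-suc v n)) (v 0 ∷ digitSum∈B (v ∘ suc) n)

∈B⇒B : ∀ {n z} → z ∈B n → B n z
∈B⇒B {n} (v , refl) = digitSum∈B v n

B⇒∈B : ∀ {n z} → B n z → z ∈B n
B⇒∈B [ d ] = (λ _ → d) , refl
B⇒∈B {suc n} (d ∷ b) with B⇒∈B b
... | v , refl = digits , digitSum-suc digits n
  where
  digits : ℕ → Digit
  digits zero    = d
  digits (suc k) = v k

rotate : Digit → Digit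
rotate d0  = d0
rotate d1  = di
rotate di  = d-1
rotate d-1 = d-i
rotate d-i = d1

iᵍ⊗⟦⟧ : ∀ d → iᵍ ⊗ ⟦ d ⟧ ≡ ⟦ rotate d ⟧
iᵍ⊗⟦⟧ d0  = refl
iᵍ⊗⟦⟧ d1  = refl
iᵍ⊗⟦⟧ di  = refl
iᵍ⊗⟦⟧ d-1 = refl
iᵍ⊗⟦⟧ d-i = refl

conjDigit : Digit → Digit
conjDigit di  = d-i
conjDigit d-i = di
conjDigit d   = d

conj⟦⟧ : ∀ d → conj ⟦ d ⟧ ≡ ⟦ conjDigit d ⟧
conj⟦⟧ d0  = refl
conj⟦⟧ d1  = refl
conj⟦⟧ di  = refl
conj⟦⟧ d-1 = refl
conj⟦⟧ d-i = refl

B-iᵍ⊗ : ∀ {n z} → B n z → B n (iᵍ ⊗ z)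
B-iᵍ⊗ [ d ] = subst (B 0) (sym (iᵍ⊗⟦⟧ d)) [ rotate d ]
B-iᵍ⊗ (_∷_ {w = w} d b) = subst (B _) (sym eq) (rotate d ∷ B-iᵍ⊗ b)
  where
  open ≡-Reasoning
  eq : iᵍ ⊗ (⟦ d ⟧ ⊕ ρ ⊗ w) ≡ ⟦ rotate d ⟧ ⊕ ρ ⊗ (iᵍ ⊗ w)
  eq = begin
    iᵍ ⊗ (⟦ d ⟧ ⊕ ρ ⊗ w)          ≡⟨ ⊗-distribˡ-⊕ iᵍ ⟦ d ⟧ (ρ ⊗ w) ⟩
    iᵍ ⊗ ⟦ d ⟧ ⊕ iᵍ ⊗ (ρ ⊗ w)      ≡⟨ cong₂ _⊕_ (iᵍ⊗⟦⟧ d) (⊗-left-comm iᵍ ρ w) ⟩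
    ⟦ rotate d ⟧ ⊕ ρ ⊗ (iᵍ ⊗ w)   ∎

B-unit⊗ : ∀ k {n z} → B n z → B n (iᵍ ^ᵍ k ⊗ z)
B-unit⊗ zero    {z = z} b = subst (B _) (sym (⊗-identityˡ z)) b
B-unit⊗ (suc k) {z = z} b = subst (B _) (sym (⊗-assoc iᵍ (iᵍ ^ᵍ k) z)) (B-iᵍ⊗ (B-unit⊗ k b))

B-conj : ∀ {n z} → B n z → B n (conj z)
B-conj [ d ] = subst (B 0) (sym (conj⟦⟧ d)) [ conjDigit d ]
B-conj (_∷_ {w = w} d b) = subst (B _) (sym eq) (conjDigit d ∷ B-unit⊗ 3 (B-conj b))
  where
  open ≡-Reasoning
  -- conj ρ = ρ ⊗ iᵍ ^ᵍ 3 holds by computation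
  eq : conj (⟦ d ⟧ ⊕ ρ ⊗ w) ≡ ⟦ conjDigit d ⟧ ⊕ ρ ⊗ (iᵍ ^ᵍ 3 ⊗ conj w)
  eq = begin
    conj (⟦ d ⟧ ⊕ ρ ⊗ w)                   ≡⟨ conj-⊕ ⟦ d ⟧ (ρ ⊗ w) ⟩
    conj ⟦ d ⟧ ⊕ conj (ρ ⊗ w)              ≡⟨ cong₂ _⊕_ (conj⟦⟧ d) (conj-⊗ ρ w) ⟩
    ⟦ conjDigit d ⟧ ⊕ (ρ ⊗ iᵍ ^ᵍ 3) ⊗ conj w  ≡⟨ cong (⟦ conjDigit d ⟧ ⊕_) (⊗-assoc ρ (iᵍ ^ᵍ 3) (conj w)) ⟩
    ⟦ conjDigit d ⟧ ⊕ ρ ⊗ (iᵍ ^ᵍ 3 ⊗ conj w)  ∎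

-- Since ρ maps (a, b) to (a - b, a + b), the octagon of B (suc n) = digits + ρ B n has
-- |re|, |im| ≤ 1 + diag n and |re ± im| ≤ 1 + 2 half (suc n).
half : ℕ → ℕ
half zero          = 0
half (suc zero)    = 1
half (suc (suc n)) = suc (suc (half n ℕ.+ half n))

diag : ℕ → ℕ
diag n = suc (half n ℕ.+ half n)

record Octagon (n : ℕ) (z : ℤ[i]) : Set where
  constructor octagon
  field
    ∣re∣≤    : ∣ re z ∣ ≤ half (suc n)
    ∣im∣≤    : ∣ im z ∣ ≤ half (suc n)
    ∣re+im∣≤ : ∣ re+im z ∣ ≤ diag n
    ∣re-im∣≤ : ∣ re-im z ∣ ≤ diag n

half-< : ∀ n → half n < half (suc n)
half-< n = proj₁ (bounds n)
  where
  bounds : ∀ n → half n < half (suc n) × half (suc n) ≤ diag n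
  bounds zero    = s≤s z≤n , s≤s z≤n
  bounds (suc n) with bounds n
  ... | h<h′ , h′≤ = s≤s h′≤ , s≤s (ℕₚ.≤-trans (s≤s (ℕₚ.+-monoʳ-≤ (half n) (ℕₚ.n≤1+n _))) (ℕₚ.+-mono-≤ h<h′ h<h′))

digit-octagon : ∀ d → Octagon 0 ⟦ d ⟧
digit-octagon d0  = octagon z≤n z≤n z≤n z≤n
digit-octagon d1  = octagon (s≤s z≤n) z≤n (s≤s z≤n) (s≤s z≤n)
digit-octagon d-1 = octagon (s≤s z≤n) z≤n (s≤s z≤n) (s≤s z≤n)
digit-octagon di  = octagon z≤n (s≤s z≤n) (s≤s z≤n) (s≤s z≤n)
digit-octagon d-i = octagon z≤n (s≤s z≤n) (s≤s z≤n) (s≤s z≤n)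

Octagon-∷ : ∀ {n} d {w} → Octagon n w → Octagon (suc n) (⟦ d ⟧ ⊕ ρ ⊗ w)
Octagon-∷ d {a + b i} (octagon ∣a∣ ∣b∣ ∣a+b∣ ∣a-b∣) with digit-octagon d
... | octagon ∣δ₁∣ ∣δ₂∣ ∣δ₁+δ₂∣ ∣δ₁-δ₂∣ = octagon
  (∣∣≤-≡ (re-law δ₁ a b) (∣+∣≤ δ₁ (a - b) ∣δ₁∣ ∣a-b∣))
  (∣∣≤-≡ (im-law δ₂ a b) (∣+∣≤ δ₂ (a + b) ∣δ₂∣ ∣a+b∣))
  (∣∣≤-≡ (re+im-law δ₁ δ₂ a b) (∣+∣≤ (δ₁ + δ₂) (a + a) ∣δ₁+δ₂∣ (∣+∣≤ a a ∣a∣ ∣a∣)))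
  (∣∣≤-≡ (re-im-law δ₁ δ₂ a b) (∣+∣≤ (δ₁ - δ₂) (- b + - b) ∣δ₁-δ₂∣ (∣+∣≤ (- b) (- b) ∣-b∣ ∣-b∣)))
  where
  δ₁ = re ⟦ d ⟧
  δ₂ = im ⟦ d ⟧
  ∣-b∣ = ∣-∣≤ b ∣b∣
  re-law : ∀ δ a b → δ + (+ 1 * a - + 1 * b) ≡ δ + (a - b)
  re-law = solve-∀
  im-law : ∀ δ a b → δ + (+ 1 * b + + 1 * a) ≡ δ + (a + b)
  im-law = solve-∀
  re+im-law : ∀ δ₁ δ₂ a b → (δ₁ + (+ 1 * a - + 1 * b)) + (δ₂ + (+ 1 * b + + 1 * a)) ≡ (δ₁ + δ₂) + (a + a)
  re+im-law = solve-∀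
  re-im-law : ∀ δ₁ δ₂ a b → (δ₁ + (+ 1 * a - + 1 * b)) - (δ₂ + (+ 1 * b + + 1 * a)) ≡ (δ₁ - δ₂) + (- b + - b)
  re-im-law = solve-∀

B⇒Octagon : ∀ {n z} → B n z → Octagon n z
B⇒Octagon [ d ]   = digit-octagon d
B⇒Octagon (d ∷ b) = Octagon-∷ d (B⇒Octagon b)

Octagon-iᵍ⊗⁻ : ∀ {n} z → Octagon n (iᵍ ⊗ z) → Octagon n z
Octagon-iᵍ⊗⁻ (a + b i) (octagon ∣-b∣ ∣a∣ ∣-b+a∣ ∣-b-a∣) = octagon
  (∣∣≤-≡ (re-law a b) ∣a∣)
  (∣∣≤-≡-neg (im-law a b) ∣-b∣)
  (∣∣≤-≡-neg (re+im-law a b) ∣-b-a∣)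
  (∣∣≤-≡ (re-im-law a b) ∣-b+a∣)
  where
  re-law : ∀ a b → a ≡ + 0 * b + + 1 * a
  re-law = solve-∀
  im-law : ∀ a b → b ≡ - (+ 0 * a - + 1 * b)
  im-law = solve-∀
  re+im-law : ∀ a b → a + b ≡ - ((+ 0 * a - + 1 * b) - (+ 0 * b + + 1 * a))
  re+im-law = solve-∀
  re-im-law : ∀ a b → a - b ≡ (+ 0 * a - + 1 * b) + (+ 0 * b + + 1 * a)
  re-im-law = solve-∀

Octagon-unit⊗⁻ : ∀ k {n} z → Octagon n (iᵍ ^ᵍ k ⊗ z) → Octagon n z
Octagon-unit⊗⁻ zero    z oc = subst (Octagon _) (⊗-identityˡ z) oc
Octagon-unit⊗⁻ (suc k) z oc =
  Octagon-unit⊗⁻ k z (Octagon-iᵍ⊗⁻ _ (subst (Octagon _) (⊗-assoc iᵍ (iᵍ ^ᵍ k) z) oc))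

Octagon-conj⁻ : ∀ {n} z → Octagon n (conj z) → Octagon n z
Octagon-conj⁻ (a + b i) (octagon ∣a∣ ∣-b∣ ∣a-b∣ ∣a+b∣) = octagon
  ∣a∣
  (∣∣≤-≡-neg (sym (ℤₚ.neg-involutive b)) ∣-b∣)
  (∣∣≤-≡ (cong (λ t → a + t) (sym (ℤₚ.neg-involutive b))) ∣a+b∣)
  ∣a-b∣

ρ∣_ : ℤ[i] → Set
ρ∣ z = Σ ℤ[i] λ w → z ≡ ρ ⊗ w

OddSum : ℤ[i] → Set
OddSum z = Σ ℤ λ k → re+im z ≡ + 1 + (k + k)

re+im-ρ⊗ : ∀ w → re+im (ρ ⊗ w) ≡ re w + re w
re+im-ρ⊗ (a + b i) = law a b
  where
  law : ∀ a b → (+ 1 * a - + 1 * b) + (+ 1 * b + + 1 * a) ≡ a + a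
  law = solve-∀

im-re-ρ⊗ : ∀ w → im (ρ ⊗ w) - re (ρ ⊗ w) ≡ im w + im w
im-re-ρ⊗ (a + b i) = law a b
  where
  law : ∀ a b → (+ 1 * b + + 1 * a) - (+ 1 * a - + 1 * b) ≡ b + b
  law = solve-∀

ρ⊗-injective : ∀ {u w} → ρ ⊗ u ≡ ρ ⊗ w → u ≡ w
ρ⊗-injective {u} {w} eq = cong₂ _+_i
  (double-injective (trans (sym (re+im-ρ⊗ u)) (trans (cong re+im eq) (re+im-ρ⊗ w))))
  (double-injective (trans (sym (im-re-ρ⊗ u)) (trans (cong (λ z → im z - re z) eq) (im-re-ρ⊗ w))))

¬OddSum-ρ⊗ : ∀ w → ¬ OddSum (ρ ⊗ w)
¬OddSum-ρ⊗ w (k , eq) = even≢odd (re w) k (trans (sym (re+im-ρ⊗ w)) eq)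

OddSum-∷ : ∀ {z} w → OddSum z → OddSum (z ⊕ ρ ⊗ w)
OddSum-∷ {c + d i} (a + b i) (k , eq) = k + a , trans (law₁ c d a b) (trans (cong (_+ (a + a)) eq) (law₂ k a))
  where
  law₁ : ∀ c d a b → (c + (+ 1 * a - + 1 * b)) + (d + (+ 1 * b + + 1 * a)) ≡ (c + d) + (a + a)
  law₁ = solve-∀
  law₂ : ∀ k a → (+ 1 + (k + k)) + (a + a) ≡ + 1 + ((k + a) + (k + a))
  law₂ = solve-∀

d0⊎OddSum : ∀ d → d ≡ d0 ⊎ OddSum ⟦ d ⟧
d0⊎OddSum d0  = inj₁ refl
d0⊎OddSum d1  = inj₂ (+ 0 , refl)
d0⊎OddSum di  = inj₂ (+ 0 , refl)
d0⊎OddSum d-1 = inj₂ (-[1+ 0 ] , refl)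
d0⊎OddSum d-i = inj₂ (-[1+ 0 ] , refl)

oddBase : ℕ → ℕ → ℤ[i]
oddBase s t = (+ suc (s ℕ.+ s)) + (+ (t ℕ.+ t)) i

-- Normal form of the Gaussian integers not divisible by ρ (see ρ∣⊎Odd): up to a unit and
-- conjugation, the real part is odd and positive and the imaginary part is even and nonnegative.
data Odd : ℤ[i] → Set where
  unit⊗base      : ∀ k s t → Odd (iᵍ ^ᵍ k ⊗ oddBase s t)
  unit⊗conj-base : ∀ k s t → Odd (iᵍ ^ᵍ k ⊗ conj (oddBase s t))

Odd-iᵍ⊗ : ∀ {z} → Odd z → Odd (iᵍ ⊗ z)
Odd-iᵍ⊗ (unit⊗base k s t) =
  subst Odd (⊗-assoc iᵍ (iᵍ ^ᵍ k) (oddBase s t)) (unit⊗base (suc k) s t)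
Odd-iᵍ⊗ (unit⊗conj-base k s t) =
  subst Odd (⊗-assoc iᵍ (iᵍ ^ᵍ k) (conj (oddBase s t))) (unit⊗conj-base (suc k) s t)

-[1+]-double : ∀ t → - + (suc t ℕ.+ suc t) ≡ -[1+ t ] + -[1+ t ]
-[1+]-double t = cong -[1+_] (ℕₚ.+-suc t t)

Odd-odd-re : ∀ α β → Odd ((+ 1 + (α + α)) + (β + β) i)
Odd-odd-re (+ s)    (+ t)    = subst Odd (⊗-identityˡ _) (unit⊗base 0 s t)
Odd-odd-re (+ s)    -[1+ t ] = subst Odd
  (trans (⊗-identityˡ _) (cong (λ m → (+ suc (s ℕ.+ s)) + m i) (-[1+]-double t)))
  (unit⊗conj-base 0 s (suc t))
Odd-odd-re -[1+ s ] (+ t)    = subst Odd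
  (trans (iᵍ²⊗ (+ suc (s ℕ.+ s)) (- + (t ℕ.+ t))) (cong (λ m → -[1+ s ℕ.+ s ] + m i) (ℤₚ.neg-involutive _)))
  (unit⊗conj-base 2 s t)
Odd-odd-re -[1+ s ] -[1+ t ] = subst Odd
  (trans (iᵍ²⊗ (+ suc (s ℕ.+ s)) (+ (suc t ℕ.+ suc t))) (cong (λ m → -[1+ s ℕ.+ s ] + m i) (-[1+]-double t)))
  (unit⊗base 2 s (suc t))

ρ∣⊎Odd : ∀ z → ρ∣ z ⊎ Odd z
ρ∣⊎Odd (a + b i) with halve a | halve b
... | α , inj₁ refl | β , inj₁ refl = inj₁ ((α + β) + (β - α) i , cong₂ _+_i (re-law α β) (im-law α β))
  where
  re-law : ∀ α β → α + α ≡ + 1 * (α + β) - + 1 * (β - α)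
  re-law = solve-∀
  im-law : ∀ α β → β + β ≡ + 1 * (β - α) + + 1 * (α + β)
  im-law = solve-∀
... | α , inj₂ refl | β , inj₂ refl =
  inj₁ ((+ 1 + α + β) + (β - α) i , cong₂ _+_i (re-law α β) (im-law α β))
  where
  re-law : ∀ α β → + 1 + (α + α) ≡ + 1 * (+ 1 + α + β) - + 1 * (β - α)
  re-law = solve-∀
  im-law : ∀ α β → + 1 + (β + β) ≡ + 1 * (β - α) + + 1 * (+ 1 + α + β)
  im-law = solve-∀
... | α , inj₂ refl | β , inj₁ refl = inj₂ (Odd-odd-re α β)
... | α , inj₁ refl | β , inj₂ refl =
  inj₂ (subst Odd (cong₂ _+_i (re-law α β) (im-law α β)) (Odd-iᵍ⊗ (Odd-odd-re β (- α))))
  where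
  re-law : ∀ α β → + 0 * (+ 1 + (β + β)) - + 1 * (- α + - α) ≡ α + α
  re-law = solve-∀
  im-law : ∀ α β → + 0 * (- α + - α) + + 1 * (+ 1 + (β + β)) ≡ + 1 + (β + β)
  im-law = solve-∀

OddSum⇒Odd : ∀ {z} → OddSum z → Odd z
OddSum⇒Odd {z} odd with ρ∣⊎Odd z
... | inj₁ (w , refl) = ⊥-elim (¬OddSum-ρ⊗ w odd)
... | inj₂ o          = o

-- ρ-adic digit extraction: the unit digit is chosen so that the quotient w is odd and lies in
-- the octagon one level down.
mutual
  oddBase∈B : ∀ n s t → Octagon n (oddBase s t) → B n (oddBase s t)
  oddBase∈B zero    zero zero    _                        = [ d1 ]
  oddBase∈B zero    (suc s) _    (octagon (s≤s ()) _ _ _)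
  oddBase∈B zero    zero (suc t) (octagon _ _ (s≤s ()) _)
  oddBase∈B (suc m) s zero (octagon ∣re∣ _ _ _) =
    subst (B _) (cong₂ _+_i (re-law (+ s)) (im-law (+ s))) (d-i ∷ Odd∩Octagon⇒B m (OddSum⇒Odd w-odd) w-oct)
    where
    w = (+ suc s) + (- + s) i
    re-law : ∀ s → + 0 + (+ 1 * (+ 1 + s) - + 1 * (- s)) ≡ + 1 + (s + s)
    re-law = solve-∀
    im-law : ∀ s → -[1+ 0 ] + (+ 1 * (- s) + + 1 * (+ 1 + s)) ≡ + 0
    im-law = solve-∀
    re+im-law : ∀ s → (+ 1 + s) + - s ≡ + 1 + (+ 0 + + 0)
    re+im-law = solve-∀
    re-im-law : ∀ s → (+ 1 + s) - - s ≡ + 1 + (s + s)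
    re-im-law = solve-∀
    s≤h : s ≤ half m
    s≤h = double-cancel-≤ (ℕₚ.≤-pred ∣re∣)
    s<h′ : s < half (suc m)
    s<h′ = ℕₚ.≤-trans (s≤s s≤h) (half-< m)
    w-odd : OddSum w
    w-odd = + 0 , re+im-law (+ s)
    w-oct : Octagon m w
    w-oct = octagon s<h′ (∣-∣≤ (+ s) (ℕₚ.<⇒≤ s<h′))
                    (∣∣≤-≡ (re+im-law (+ s)) (s≤s z≤n)) (∣∣≤-≡ (re-im-law (+ s)) (double-mono-≤ s≤h))
  oddBase∈B (suc m) s (suc t) (octagon ∣re∣ ∣im∣ ∣re+im∣ _) =
    subst (B _) (cong₂ _+_i (re-law (+ s) (+ t)) (im-law (+ s) (+ t)))
          (di ∷ Odd∩Octagon⇒B m (OddSum⇒Odd w-odd) w-oct)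
    where
    w = (+ suc (s ℕ.+ t)) + (+ t - + s) i
    re-law : ∀ s t → + 0 + (+ 1 * (+ 1 + (s + t)) - + 1 * (t - s)) ≡ + 1 + (s + s)
    re-law = solve-∀
    im-law : ∀ s t → + 1 + (+ 1 * (t - s) + + 1 * (+ 1 + (s + t))) ≡ (+ 1 + t) + (+ 1 + t)
    im-law = solve-∀
    re+im-law : ∀ s t → (+ 1 + (s + t)) + (t - s) ≡ + 1 + (t + t)
    re+im-law = solve-∀
    re-im-law : ∀ s t → (+ 1 + (s + t)) - (t - s) ≡ + 1 + (s + s)
    re-im-law = solve-∀
    regroup : ∀ s t → suc (s ℕ.+ t) ℕ.+ suc (s ℕ.+ t) ≡ (s ℕ.+ s) ℕ.+ (suc t ℕ.+ suc t)
    regroup = ℕ-solve-∀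
    s≤h : s ≤ half m
    s≤h = double-cancel-≤ (ℕₚ.≤-pred ∣re∣)
    t≤h : t ≤ half m
    t≤h = double-cancel-≤ (ℕₚ.≤-trans (ℕₚ.n≤1+n _)
                            (ℕₚ.≤-pred (subst (_≤ half (suc (suc m))) (cong suc (ℕₚ.+-suc t t)) ∣im∣)))
    s+t<h′ : suc (s ℕ.+ t) ≤ half (suc m)
    s+t<h′ = double-cancel-≤ (ℕₚ.≤-trans (ℕₚ.≤-reflexive (regroup s t)) (ℕₚ.≤-trans (ℕₚ.≤-pred ∣re+im∣) (ℕₚ.n≤1+n _)))
    w-odd : OddSum w
    w-odd = + t , re+im-law (+ s) (+ t)
    w-oct : Octagon m w
    w-oct = octagon s+t<h′
                    (ℕₚ.≤-trans (ℤₚ.∣i-j∣≤∣i∣+∣j∣ (+ t) (+ s))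
                                (ℕₚ.≤-trans (ℕₚ.≤-reflexive (ℕₚ.+-comm t s)) (ℕₚ.<⇒≤ s+t<h′)))
                    (∣∣≤-≡ (re+im-law (+ s) (+ t)) (double-mono-≤ t≤h))
                    (∣∣≤-≡ (re-im-law (+ s) (+ t)) (double-mono-≤ s≤h))

  Odd∩Octagon⇒B : ∀ n {z} → Odd z → Octagon n z → B n z
  Odd∩Octagon⇒B n (unit⊗base k s t) oc = B-unit⊗ k (oddBase∈B n s t (Octagon-unit⊗⁻ k _ oc))
  Odd∩Octagon⇒B n (unit⊗conj-base k s t) oc =
    B-unit⊗ k (B-conj (oddBase∈B n s t (Octagon-conj⁻ _ (Octagon-unit⊗⁻ k _ oc))))

norm : ℤ[i] → ℕ
norm z = ∣ re z ∣ ℕ.* ∣ re z ∣ ℕ.+ ∣ im z ∣ ℕ.* ∣ im z ∣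

norm-⊗ : ∀ x y → norm (x ⊗ y) ≡ norm x ℕ.* norm y
norm-⊗ (a + b i) (c + d i) = ℤₚ.+-injective (begin
  + norm ((a + b i) ⊗ (c + d i))
    ≡⟨ cong₂ _+_ (∣i∣*∣i∣≡i*i (a * c - b * d)) (∣i∣*∣i∣≡i*i (a * d + b * c)) ⟩
  (a * c - b * d) * (a * c - b * d) + (a * d + b * c) * (a * d + b * c)
    ≡⟨ law a b c d ⟩
  (a * a + b * b) * (c * c + d * d)
    ≡⟨ cong₂ _*_ (cong₂ _+_ (∣i∣*∣i∣≡i*i a) (∣i∣*∣i∣≡i*i b)) (cong₂ _+_ (∣i∣*∣i∣≡i*i c) (∣i∣*∣i∣≡i*i d)) ⟨
  + norm (a + b i) * + norm (c + d i)
    ≡⟨ ℤₚ.pos-* (norm (a + b i)) (norm (c + d i)) ⟨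
  + (norm (a + b i) ℕ.* norm (c + d i)) ∎)
  where
  open ≡-Reasoning
  law : ∀ a b c d → (a * c - b * d) * (a * c - b * d) + (a * d + b * c) * (a * d + b * c)
                    ≡ (a * a + b * b) * (c * c + d * d)
  law = solve-∀

norm-parallelogram : ∀ z → ∣ re+im z ∣ ℕ.* ∣ re+im z ∣ ℕ.+ ∣ re-im z ∣ ℕ.* ∣ re-im z ∣ ≡ norm z ℕ.+ norm z
norm-parallelogram (a + b i) = ℤₚ.+-injective (begin
  + (∣ a + b ∣ ℕ.* ∣ a + b ∣) + + (∣ a - b ∣ ℕ.* ∣ a - b ∣)
    ≡⟨ cong₂ _+_ (∣i∣*∣i∣≡i*i (a + b)) (∣i∣*∣i∣≡i*i (a - b)) ⟩
  (a + b) * (a + b) + (a - b) * (a - b)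
    ≡⟨ law a b ⟩
  (a * a + b * b) + (a * a + b * b)
    ≡⟨ cong₂ _+_ N≡ N≡ ⟨
  + norm (a + b i) + + norm (a + b i) ∎)
  where
  open ≡-Reasoning
  N≡ : + norm (a + b i) ≡ a * a + b * b
  N≡ = cong₂ _+_ (∣i∣*∣i∣≡i*i a) (∣i∣*∣i∣≡i*i b)
  law : ∀ a b → (a + b) * (a + b) + (a - b) * (a - b) ≡ (a * a + b * b) + (a * a + b * b)
  law = solve-∀

Octagon⇒norm≤ : ∀ {n z} → Octagon n z →
                norm z ≤ half (suc n) ℕ.* half (suc n) ℕ.+ half (suc n) ℕ.* half (suc n) ×
                norm z ≤ diag n ℕ.* diag n
Octagon⇒norm≤ {z = z} (octagon ∣re∣ ∣im∣ ∣re+im∣ ∣re-im∣) =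
  ℕₚ.+-mono-≤ (ℕₚ.*-mono-≤ ∣re∣ ∣re∣) (ℕₚ.*-mono-≤ ∣im∣ ∣im∣) ,
  double-cancel-≤ (ℕₚ.≤-trans (ℕₚ.≤-reflexive (sym (norm-parallelogram z)))
                  (ℕₚ.≤-trans (ℕₚ.+-mono-≤ (ℕₚ.*-mono-≤ ∣re+im∣ ∣re+im∣) (ℕₚ.*-mono-≤ ∣re-im∣ ∣re-im∣))
                              (ℕₚ.n≤1+n _)))

norm≤⇒Octagon : ∀ {n} z → norm z ≤ half (suc n) ℕ.* half (suc n) → norm z ℕ.+ norm z ≤ diag n ℕ.* diag n →
                Octagon n z
norm≤⇒Octagon z p q = octagon
  (square-cancel-≤ (ℕₚ.≤-trans (ℕₚ.m≤m+n _ _) p))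
  (square-cancel-≤ (ℕₚ.≤-trans (ℕₚ.m≤n+m _ _) p))
  (square-cancel-≤ (ℕₚ.≤-trans (ℕₚ.m≤m+n _ _) q′))
  (square-cancel-≤ (ℕₚ.≤-trans (ℕₚ.m≤n+m _ _) q′))
  where
  q′ = ℕₚ.≤-trans (ℕₚ.≤-reflexive (norm-parallelogram z)) q

Octagon-cancelʳ-norm : ∀ {n} x y → 2 ≤ norm y → Octagon n (x ⊗ y) → Octagon n x
Octagon-cancelʳ-norm x y 2≤N oc with Octagon⇒norm≤ oc
... | ≤side² , ≤diag² = norm≤⇒Octagon x
  (double-cancel-≤ (ℕₚ.≤-trans 2N≤ (ℕₚ.≤-trans ≤side² (ℕₚ.n≤1+n _))))
  (ℕₚ.≤-trans 2N≤ ≤diag²)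
  where
  N = norm x
  2N≤ : N ℕ.+ N ≤ norm (x ⊗ y)
  2N≤ = begin
    N ℕ.+ N         ≡⟨ cong (N ℕ.+_) (ℕₚ.+-identityʳ N) ⟨
    2 ℕ.* N         ≤⟨ ℕₚ.*-monoˡ-≤ N 2≤N ⟩
    norm y ℕ.* N    ≡⟨ ℕₚ.*-comm (norm y) N ⟩
    N ℕ.* norm y    ≡⟨ norm-⊗ x y ⟨
    norm (x ⊗ y)    ∎
    where open ℕₚ.≤-Reasoning

zero⊎unit⊎norm≥2 : ∀ y → y ≡ 0ᵍ ⊎ Σ ℕ (λ k → y ≡ iᵍ ^ᵍ k) ⊎ 2 ≤ norm y
zero⊎unit⊎norm≥2 ((+ 0)           + (+ 0)           i) = inj₁ refl
zero⊎unit⊎norm≥2 ((+ 1)           + (+ 0)           i) = inj₂ (inj₁ (0 , refl))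
zero⊎unit⊎norm≥2 ((+ 0)           + (+ 1)           i) = inj₂ (inj₁ (1 , refl))
zero⊎unit⊎norm≥2 (-[1+ 0 ]        + (+ 0)           i) = inj₂ (inj₁ (2 , refl))
zero⊎unit⊎norm≥2 ((+ 0)           + -[1+ 0 ]        i) = inj₂ (inj₁ (3 , refl))
zero⊎unit⊎norm≥2 ((+ 0)           + (+ suc (suc _)) i) = inj₂ (inj₂ (s≤s (s≤s z≤n)))
zero⊎unit⊎norm≥2 ((+ 0)           + -[1+ suc _ ]    i) = inj₂ (inj₂ (s≤s (s≤s z≤n)))
zero⊎unit⊎norm≥2 ((+ 1)           + (+ suc _)       i) = inj₂ (inj₂ (s≤s (s≤s z≤n)))
zero⊎unit⊎norm≥2 ((+ 1)           + -[1+ _ ]        i) = inj₂ (inj₂ (s≤s (s≤s z≤n)))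
zero⊎unit⊎norm≥2 (-[1+ 0 ]        + (+ suc _)       i) = inj₂ (inj₂ (s≤s (s≤s z≤n)))
zero⊎unit⊎norm≥2 (-[1+ 0 ]        + -[1+ _ ]        i) = inj₂ (inj₂ (s≤s (s≤s z≤n)))
zero⊎unit⊎norm≥2 ((+ suc (suc _)) + _               i) = inj₂ (inj₂ (s≤s (s≤s z≤n)))
zero⊎unit⊎norm≥2 (-[1+ suc _ ]    + _               i) = inj₂ (inj₂ (s≤s (s≤s z≤n)))

Octagon-cancelʳ : ∀ {n} x y → x ⊗ y ≢ 0ᵍ → Octagon n (x ⊗ y) → Octagon n x
Octagon-cancelʳ x y xy≢0 oc with zero⊎unit⊎norm≥2 y
... | inj₁ refl                = ⊥-elim (xy≢0 (⊗-zeroʳ x))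
... | inj₂ (inj₁ (k , refl))   = Octagon-unit⊗⁻ k x (subst (Octagon _) (⊗-comm x (iᵍ ^ᵍ k)) oc)
... | inj₂ (inj₂ 2≤N)          = Octagon-cancelʳ-norm x y 2≤N oc

B-ρ⊗⁻ : ∀ {m u z} → z ≡ ρ ⊗ u → B (suc m) z → B m u
B-ρ⊗⁻ {u = u} eq (_∷_ {w = w} d b) with d0⊎OddSum d
... | inj₁ refl = subst (B _) (ρ⊗-injective (trans (sym (⊕-identityˡ (ρ ⊗ w))) eq)) b
... | inj₂ odd  = ⊥-elim (¬OddSum-ρ⊗ u (subst OddSum eq (OddSum-∷ {⟦ d ⟧} w odd)))

B₀-ρ⊗ : ∀ {u z} → z ≡ ρ ⊗ u → B 0 z → u ≡ 0ᵍ
B₀-ρ⊗ {u = u} eq [ d ] with d0⊎OddSum d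
... | inj₁ refl = sym (ρ⊗-injective eq)
... | inj₂ odd  = ⊥-elim (¬OddSum-ρ⊗ u (subst OddSum eq odd))

B-divisor : ∀ n x y → B n (x ⊗ y) → x ⊗ y ≢ 0ᵍ → B n x
B-divisor n x y b xy≢0 with ρ∣⊎Odd x
... | inj₂ odd = Odd∩Octagon⇒B n odd (Octagon-cancelʳ x y xy≢0 (B⇒Octagon b))
B-divisor zero    _ y b xy≢0 | inj₁ (x′ , refl) =
  ⊥-elim (xy≢0 (trans (⊗-assoc ρ x′ y) (cong (ρ ⊗_) (B₀-ρ⊗ {x′ ⊗ y} (⊗-assoc ρ x′ y) b))))
B-divisor (suc m) _ y b xy≢0 | inj₁ (x′ , refl) =
  subst (B _) (⊕-identityˡ (ρ ⊗ x′))
        (d0 ∷ B-divisor m x′ y (B-ρ⊗⁻ (⊗-assoc ρ x′ y) b) (xy≢0 ∘ trans (⊗-assoc ρ x′ y) ∘ cong (ρ ⊗_)))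

lemma2p18 : (n : ℕ) (x y : ℤ[i]) → (x ⊗ y) ∈B n → x ⊗ y ≢ 0ᵍ → x ∈B n × x ≢ 0ᵍ
lemma2p18 n x y xy∈B xy≢0 = B⇒∈B (B-divisor n x y (∈B⇒B xy∈B) xy≢0) , λ { refl → xy≢0 refl }
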